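{- Let $p$ be a prime. Let $X$, $Y$ and $Z$ be subsets of $\mathbb{Z}_p$ and let $1 \leq c_1 \leq |X|$ and $1 \leq c_2 \leq |Y|$ be integers such that $c_1c_2 \geq 16 |X|$. Suppose that $8|X| \leq |Y|$, $8|Z| \leq |Y|$ and $|Y|<p/2$. Then there exist $X' \in X^{(c_1)}$ and $Y' \in Y^{(c_2)}$ such that $|(X'+Y')\setminus Z| \geq 2|X|$.
   Context: For a finite set $S$ and integer $m$, $S^{(m)}$ denotes the family of all $m$-element subsets of $S$. $X'+Y'$ denotes the sumset. -}

module Defs where

open import Data.Nat using (ℕ; NonZero; _+_; _%_)
open import Data.Nat.DivMod using (m%n<n)
open import Data.Fin using (Fin; toℕ; fromℕ<)
open import Data.Fin.Subset using (Subset; _∈_)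
open import Data.Fin.Subset.Properties using (_∈?_)
open import Data.Fin.Properties using (any?; _≟_)
open import Data.Product using (Σ; _×_; _,_)
open import Data.Vec using (tabulate)
open import Relation.Binary.PropositionalEquality using (_≡_)
open import Relation.Nullary.Decidable using (Dec; ⌊_⌋; _×-dec_)

_+ₚ_ : ∀ {p} .{{_ : NonZero p}} → Fin p → Fin p → Fin p
_+ₚ_ {p} x y = fromℕ< (m%n<n (toℕ x + toℕ y) p)

InSumset : ∀ {p} .{{_ : NonZero p}} → Subset p → Subset p → Fin p → Set
InSumset A B z = Σ _ λ a → Σ _ λ b → (a ∈ A × b ∈ B) × (a +ₚ b) ≡ z

inSumset? : ∀ {p} .{{_ : NonZero p}} (A B : Subset p) (z : Fin p) → Dec (InSumset A B z)
inSumset? A B z =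
  any? λ a → any? λ b → ((a ∈? A) ×-dec (b ∈? B)) ×-dec ((a +ₚ b) ≟ z)

_⊕_ : ∀ {p} .{{_ : NonZero p}} → Subset p → Subset p → Subset p
A ⊕ B = tabulate λ z → ⌊ inSumset? A B z ⌋

-- Fix any c₁-element X′ ⊆ X and choose translates y ∈ Y greedily, keeping a duplicate-free list of
-- elements of (X′ + chosen) ∖ Z. While fewer than 2|X| of them are known, the blocked set (these sums
-- together with Z) has fewer than |Y|/2 elements. Since y ↦ x + y is injective, each x ∈ X′ hits the
-- blocked set for fewer than |Y|/2 values of y, so double counting yields a y ∈ Y for which at least
-- half of X′ + y is new. After c₂ rounds we have found either 2|X| sums or at least c₁c₂/2 ≥ 8|X| of
-- them, and it only remains to pad the chosen translates to exactly c₂ elements of Y.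
module Submission where

open import Defs
open import Data.Nat using (ℕ; NonZero; zero; suc; _+_; _*_; _∸_; _%_; _≤_; _<_; _≤?_; z≤n; s≤s; >-nonZero)
open import Data.Nat.Properties hiding (_≟_)
open import Data.Nat.DivMod using (%-distribˡ-+; m%n%n≡m%n; [m+n]%n≡m%n; m<n⇒m%n≡m)
open import Data.Nat.ListAction using (sum)
open import Data.Nat.Primality using (Prime)
open import Data.Nat.Tactic.RingSolver using (solve-∀)
open import Data.Fin using (Fin; toℕ; fromℕ<) renaming (zero to fzero; suc to fsuc)
open import Data.Fin.Properties using (toℕ-fromℕ<; toℕ-injective; toℕ<n; _≟_) renaming (suc-injective to fsuc-injective)
open import Data.Fin.Subset using (Subset; _⊆_; ∣_∣; _∩_; _∪_; ∁; ⊥; ⁅_⁆; inside; outside)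
  renaming (_∈_ to _∈ₛ_; _∉_ to _∉ₛ_)
open import Data.Fin.Subset.Properties
  using (drop-∷-⊆; out⊆; in⊆in; s⊆s; ⊆-refl; ⊥⊆; ∣⊥∣≡0; ∣p∣≤∣x∷p∣; ∣⁅x⁆∣≡1; x∈⁅x⁆; x∈⁅y⁆⇒x≡y;
         p⊆p∪q; q⊆p∪q; x∈p∪q⁻; x∈p∩q⁺; x∉p⇒x∈∁p)
open import Data.Vec using ([]; _∷_; here; there)
open import Data.Vec.Properties using (lookup∘tabulate; lookup⇒[]=)
open import Data.List using (List; []; _∷_; map; filter; length; _++_)
open import Data.List.Properties using (length-map; length-++; filter-notAll)
open import Data.List.Membership.Propositional using (_∈_; _∉_; find; lose)
open import Data.List.Membership.Propositional.Properties
  using (∈-map⁺; ∈-map⁻; ∈-filter⁺; ∈-filter⁻; ∈-++⁺ˡ; ∈-++⁺ʳ; ∈-++⁻)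
import Data.List.Membership.DecPropositional as DecMembership
open import Data.List.Relation.Binary.Subset.Propositional using () renaming (_⊆_ to _⊆ₗ_)
open import Data.List.Relation.Unary.Any as Any using (here; there; any?)
open import Data.List.Relation.Unary.All as All using ()
open import Data.List.Relation.Unary.AllPairs using ([]; _∷_)
open import Data.List.Relation.Unary.Unique.Propositional using (Unique)
import Data.List.Relation.Unary.Unique.Propositional.Properties as Unique
open import Data.Bool using (true)
open import Data.Product using (Σ; ∃-syntax; _×_; _,_; proj₁; proj₂)
open import Data.Sum as Sum using (_⊎_; inj₁; inj₂)
open import Data.Empty using (⊥-elim)
open import Function using (_∘_)
open import Relation.Nullary using (¬_; Dec; yes; no; ¬?; contradiction)
open import Relation.Nullary.Decidable using (⌊_⌋)
open import Relation.Unary using (Decidable)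
open import Relation.Binary using (DecidableEquality)
open import Relation.Binary.PropositionalEquality using (_≡_; _≢_; refl; sym; trans; cong; subst; module ≡-Reasoning)
open import Algebra.Properties.CommutativeSemigroup +-commutativeSemigroup
  using () renaming (x∙yz≈y∙xz to m+[n+o]≡n+[m+o])
open import Algebra.Properties.CommutativeSemigroup *-commutativeSemigroup
  using () renaming (x∙yz≈y∙xz to m*[n*o]≡n*[m*o])

module _ {p : ℕ} .{{_ : NonZero p}} where
  open ≡-Reasoning

  toℕ-+ₚ : (x y : Fin p) → toℕ (x +ₚ y) ≡ (toℕ x + toℕ y) % p
  toℕ-+ₚ x y = toℕ-fromℕ< _

  +ₚ-comm : (x y : Fin p) → x +ₚ y ≡ y +ₚ x
  +ₚ-comm x y = toℕ-injective (begin
    toℕ (x +ₚ y)          ≡⟨ toℕ-+ₚ x y ⟩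
    (toℕ x + toℕ y) % p   ≡⟨ cong (_% p) (+-comm (toℕ x) (toℕ y)) ⟩
    (toℕ y + toℕ x) % p   ≡⟨ toℕ-+ₚ y x ⟨
    toℕ (y +ₚ x)          ∎)

  [[m+n]%p+[p∸n]]%p≡m : ∀ {m n} → m < p → n ≤ p → ((m + n) % p + (p ∸ n)) % p ≡ m
  [[m+n]%p+[p∸n]]%p≡m {m} {n} m<p n≤p = begin
    ((m + n) % p + (p ∸ n)) % p           ≡⟨ %-distribˡ-+ ((m + n) % p) (p ∸ n) p ⟩
    ((m + n) % p % p + (p ∸ n) % p) % p   ≡⟨ cong (λ t → (t + (p ∸ n) % p) % p) (m%n%n≡m%n (m + n) p) ⟩
    ((m + n) % p + (p ∸ n) % p) % p       ≡⟨ %-distribˡ-+ (m + n) (p ∸ n) p ⟨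
    (m + n + (p ∸ n)) % p                 ≡⟨ cong (_% p) (+-assoc m n (p ∸ n)) ⟩
    (m + (n + (p ∸ n))) % p               ≡⟨ cong (λ t → (m + t) % p) (m+[n∸m]≡n n≤p) ⟩
    (m + p) % p                           ≡⟨ [m+n]%n≡m%n m p ⟩
    m % p                                 ≡⟨ m<n⇒m%n≡m m<p ⟩
    m                                     ∎

  +ₚ-cancelʳ : ∀ {x x′} y → x +ₚ y ≡ x′ +ₚ y → x ≡ x′
  +ₚ-cancelʳ {x} {x′} y eq = toℕ-injective (begin
    toℕ x                                       ≡⟨ subtract-y x ⟨
    ((toℕ x + toℕ y) % p + (p ∸ toℕ y)) % p     ≡⟨ cong (λ t → (t + (p ∸ toℕ y)) % p) sums ⟩
    ((toℕ x′ + toℕ y) % p + (p ∸ toℕ y)) % p    ≡⟨ subtract-y x′ ⟩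
    toℕ x′                                      ∎)
    where
    subtract-y : ∀ z → ((toℕ z + toℕ y) % p + (p ∸ toℕ y)) % p ≡ toℕ z
    subtract-y z = [[m+n]%p+[p∸n]]%p≡m (toℕ<n z) (<⇒≤ (toℕ<n y))
    sums : (toℕ x + toℕ y) % p ≡ (toℕ x′ + toℕ y) % p
    sums = trans (sym (toℕ-+ₚ x y)) (trans (cong toℕ eq) (toℕ-+ₚ x′ y))

  +ₚ-cancelˡ : ∀ x {y y′} → x +ₚ y ≡ x +ₚ y′ → y ≡ y′
  +ₚ-cancelˡ x {y} {y′} eq = +ₚ-cancelʳ x (trans (+ₚ-comm y x) (trans eq (+ₚ-comm x y′)))

module _ {b} {B : Set b} (_≟_ : DecidableEquality B) where

  length-mono-⊆ : ∀ {xs ys : List B} → Unique xs → xs ⊆ₗ ys → length xs ≤ length ys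
  length-mono-⊆ [] _ = z≤n
  length-mono-⊆ {x ∷ xs} {ys} (x∉xs ∷ xs!) x∷xs⊆ys = begin-strict
    length xs               ≤⟨ length-mono-⊆ xs! xs⊆ys-x ⟩
    length (filter ≢x? ys)  <⟨ filter-notAll ≢x? ys (Any.map (λ x≡y y≢x → y≢x (sym x≡y)) (x∷xs⊆ys (here refl))) ⟩
    length ys               ∎
    where
    open ≤-Reasoning
    ≢x? : Decidable (_≢ x)
    ≢x? y = ¬? (y ≟ x)
    xs⊆ys-x : xs ⊆ₗ filter ≢x? ys
    xs⊆ys-x y∈xs = ∈-filter⁺ ≢x? (x∷xs⊆ys (there y∈xs)) (λ y≡x → All.lookup x∉xs y∈xs (sym y≡x))

  open DecMembership _≟_ using (_∈?_)

  length-filter-preimage≤ : ∀ {a} {A : Set a} (f : A → B) → (∀ {x y} → f x ≡ f y → x ≡ y) →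
    ∀ {xs} → Unique xs → (ys : List B) → length (filter (λ x → f x ∈? ys) xs) ≤ length ys
  length-filter-preimage≤ f f-injective {xs} xs! ys = begin
    length (filter f∈ys? xs)          ≡⟨ length-map f (filter f∈ys? xs) ⟨
    length (map f (filter f∈ys? xs))  ≤⟨ length-mono-⊆ (Unique.map⁺ f-injective (Unique.filter⁺ f∈ys? xs!)) image⊆ys ⟩
    length ys                         ∎
    where
    open ≤-Reasoning
    f∈ys? : Decidable (λ x → f x ∈ ys)
    f∈ys? x = f x ∈? ys
    image⊆ys : map f (filter f∈ys? xs) ⊆ₗ ys
    image⊆ys y∈ with ∈-map⁻ f {xs = filter f∈ys? xs} y∈
    ... | x , x∈ , refl = proj₂ (∈-filter⁻ f∈ys? {xs = xs} x∈)

elements : ∀ {n} → Subset n → List (Fin n)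
elements []            = []
elements (inside ∷ s)  = fzero ∷ map fsuc (elements s)
elements (outside ∷ s) = map fsuc (elements s)

length-elements : ∀ {n} (s : Subset n) → length (elements s) ≡ ∣ s ∣
length-elements []            = refl
length-elements (inside ∷ s)  = cong suc (trans (length-map fsuc (elements s)) (length-elements s))
length-elements (outside ∷ s) = trans (length-map fsuc (elements s)) (length-elements s)

∈-elements⁺ : ∀ {n} {s : Subset n} {x} → x ∈ₛ s → x ∈ elements s
∈-elements⁺ {s = inside ∷ s}  here      = here refl
∈-elements⁺ {s = inside ∷ s}  (there x∈) = there (∈-map⁺ fsuc (∈-elements⁺ x∈))
∈-elements⁺ {s = outside ∷ s} (there x∈) = ∈-map⁺ fsuc (∈-elements⁺ x∈)

∈-elements⁻ : ∀ {n} {s : Subset n} {x} → x ∈ elements s → x ∈ₛ s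
∈-elements⁻ {s = inside ∷ s} (here refl) = here
∈-elements⁻ {s = inside ∷ s} (there x∈) with ∈-map⁻ fsuc x∈
... | _ , y∈ , refl = there (∈-elements⁻ y∈)
∈-elements⁻ {s = outside ∷ s} x∈ with ∈-map⁻ fsuc x∈
... | _ , y∈ , refl = there (∈-elements⁻ y∈)

elements-unique : ∀ {n} (s : Subset n) → Unique (elements s)
elements-unique []            = []
elements-unique (inside ∷ s)  = All.tabulate zero∉ ∷ Unique.map⁺ fsuc-injective (elements-unique s)
  where
  zero∉ : ∀ {y} → y ∈ map fsuc (elements s) → fzero ≢ y
  zero∉ y∈ refl with ∈-map⁻ fsuc y∈
  ... | _ , _ , ()
elements-unique (outside ∷ s) = Unique.map⁺ fsuc-injective (elements-unique s)

module _ {a} {A : Set a} where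

  sum-map-*ˡ : ∀ k (f : A → ℕ) xs → sum (map (λ x → k * f x) xs) ≡ k * sum (map f xs)
  sum-map-*ˡ k f []       = sym (*-zeroʳ k)
  sum-map-*ˡ k f (x ∷ xs) = trans (cong (k * f x +_) (sum-map-*ˡ k f xs)) (sym (*-distribˡ-+ k (f x) _))

  length*≤sum-map : ∀ {c} {f : A → ℕ} xs → (∀ {x} → x ∈ xs → c ≤ f x) → length xs * c ≤ sum (map f xs)
  length*≤sum-map []       _     = z≤n
  length*≤sum-map (x ∷ xs) c≤f = +-mono-≤ (c≤f (here refl)) (length*≤sum-map xs (c≤f ∘ there))

  sum-map≤length* : ∀ {c} {f : A → ℕ} xs → (∀ {x} → x ∈ xs → f x ≤ c) → sum (map f xs) ≤ length xs * c
  sum-map≤length* []       _     = z≤n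
  sum-map≤length* (x ∷ xs) f≤c = +-mono-≤ (f≤c (here refl)) (sum-map≤length* xs (f≤c ∘ there))

  length-filter+length-filter-¬ : ∀ {p} {P : A → Set p} (P? : Decidable P) xs →
    length (filter P? xs) + length (filter (¬? ∘ P?) xs) ≡ length xs
  length-filter+length-filter-¬ P? [] = refl
  length-filter+length-filter-¬ P? (x ∷ xs) with P? x
  ... | yes _ = cong suc (length-filter+length-filter-¬ P? xs)
  ... | no  _ = trans (+-suc _ _) (cong suc (length-filter+length-filter-¬ P? xs))

b+g≡n⇒2g<n⇒n<2b : ∀ {b g n} → b + g ≡ n → 2 * g < n → n < 2 * b
b+g≡n⇒2g<n⇒n<2b {b} {g} {n} b+g≡n 2g<n = +-cancelʳ-≤ (2 * g) (suc n) (2 * b) (begin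
  suc n + 2 * g     ≡⟨ +-suc n (2 * g) ⟨
  n + suc (2 * g)   ≤⟨ +-monoʳ-≤ n 2g<n ⟩
  n + n             ≡⟨ cong (n +_) (+-identityʳ n) ⟨
  2 * n             ≡⟨ cong (2 *_) b+g≡n ⟨
  2 * (b + g)       ≡⟨ *-distribˡ-+ 2 b g ⟩
  2 * b + 2 * g     ∎)
  where open ≤-Reasoning

module _ {a b r} {A : Set a} {B : Set b} {R : A → B → Set r} (R? : ∀ a b → Dec (R a b)) where

  column : List A → B → ℕ
  column as b = length (filter (λ a → R? a b) as)

  row : A → List B → ℕ
  row a bs = length (filter (R? a) bs)

  sum-column-∷ : ∀ a as bs → sum (map (column (a ∷ as)) bs) ≡ row a bs + sum (map (column as) bs)
  sum-column-∷ a as []       = refl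
  sum-column-∷ a as (b ∷ bs) with R? a b
  ... | yes _ = cong suc (trans (cong (column as b +_) (sum-column-∷ a as bs))
                                (m+[n+o]≡n+[m+o] (column as b) (row a bs) _))
  ... | no  _ = trans (cong (column as b +_) (sum-column-∷ a as bs))
                      (m+[n+o]≡n+[m+o] (column as b) (row a bs) _)

  double-counting : ∀ as bs → sum (map (column as) bs) ≡ sum (map (λ a → row a bs) as)
  double-counting []       bs =
    n≤0⇒n≡0 (≤-trans (sum-map≤length* bs (λ _ → z≤n)) (≤-reflexive (*-zeroʳ (length bs))))
  double-counting (a ∷ as) bs = trans (sum-column-∷ a as bs) (cong (row a bs +_) (double-counting as bs))

  sparse-column : ∀ as bs s → (∀ {a} → a ∈ as → row a bs ≤ s) → 2 * s < length bs →
    ∃[ b ] b ∈ bs × length as ≤ 2 * length (filter (λ a → ¬? (R? a b)) as)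
  sparse-column as bs s row≤s 2s<∣bs∣ with any? (λ b → length as ≤? 2 * length (filter (λ a → ¬? (R? a b)) as)) bs
  ... | yes found = find found
  ... | no  none  = ⊥-elim (<-irrefl refl overcounted)
    where
    n : ℕ
    n = length as
    dense : ∀ {b} → b ∈ bs → suc n ≤ 2 * column as b
    dense {b} b∈bs = b+g≡n⇒2g<n⇒n<2b {column as b}
      (length-filter+length-filter-¬ (λ a → R? a b) as) (≰⇒> (none ∘ lose b∈bs))
    instance
      bs≢0 : NonZero (length bs)
      bs≢0 = >-nonZero (≤-<-trans z≤n 2s<∣bs∣)
    open ≤-Reasoning
    overcounted : length bs * n < length bs * n
    overcounted = begin-strict
      length bs * n                       <⟨ *-monoʳ-< (length bs) (n<1+n n) ⟩
      length bs * suc n                   ≤⟨ length*≤sum-map bs dense ⟩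
      sum (map (λ b → 2 * column as b) bs) ≡⟨ sum-map-*ˡ 2 (column as) bs ⟩
      2 * sum (map (column as) bs)        ≡⟨ cong (2 *_) (double-counting as bs) ⟩
      2 * sum (map (λ a → row a bs) as)   ≤⟨ *-monoʳ-≤ 2 (sum-map≤length* as row≤s) ⟩
      2 * (n * s)                         ≡⟨ m*[n*o]≡n*[m*o] 2 n s ⟩
      n * (2 * s)                         ≤⟨ *-monoʳ-≤ n (<⇒≤ 2s<∣bs∣) ⟩
      n * length bs                       ≡⟨ *-comm n (length bs) ⟩
      length bs * n                       ∎

length≤∣_∣ : ∀ {n} (S : Subset n) {xs} → Unique xs → (∀ {x} → x ∈ xs → x ∈ₛ S) → length xs ≤ ∣ S ∣
length≤∣ S ∣ xs! xs⊆S = subst (_ ≤_) (length-elements S) (length-mono-⊆ _≟_ xs! (∈-elements⁺ ∘ xs⊆S))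

∣p∪q∣≤∣p∣+∣q∣ : ∀ {n} (p q : Subset n) → ∣ p ∪ q ∣ ≤ ∣ p ∣ + ∣ q ∣
∣p∪q∣≤∣p∣+∣q∣ []            []            = z≤n
∣p∪q∣≤∣p∣+∣q∣ (inside ∷ p)  (x ∷ q)       = s≤s (≤-trans (∣p∪q∣≤∣p∣+∣q∣ p q) (+-monoʳ-≤ ∣ p ∣ (∣p∣≤∣x∷p∣ x q)))
∣p∪q∣≤∣p∣+∣q∣ (outside ∷ p) (inside ∷ q)  = ≤-trans (s≤s (∣p∪q∣≤∣p∣+∣q∣ p q)) (≤-reflexive (sym (+-suc ∣ p ∣ ∣ q ∣)))
∣p∪q∣≤∣p∣+∣q∣ (outside ∷ p) (outside ∷ q) = ∣p∪q∣≤∣p∣+∣q∣ p q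

⊆-interpolate : ∀ {n} (A B : Subset n) k → A ⊆ B → ∣ A ∣ ≤ k → k ≤ ∣ B ∣ →
  ∃[ C ] A ⊆ C × C ⊆ B × ∣ C ∣ ≡ k
⊆-interpolate [] [] k _ _ k≤0 = [] , (λ ()) , (λ ()) , sym (n≤0⇒n≡0 k≤0)
⊆-interpolate (inside ∷ A) (outside ∷ B) k A⊆B _ _ = contradiction (A⊆B here) λ ()
⊆-interpolate (inside ∷ A) (inside ∷ B) (suc k) A⊆B (s≤s ∣A∣≤k) (s≤s k≤∣B∣)
  with C , A⊆C , C⊆B , ∣C∣≡k ← ⊆-interpolate A B k (drop-∷-⊆ A⊆B) ∣A∣≤k k≤∣B∣
  = inside ∷ C , in⊆in A⊆C , in⊆in C⊆B , cong suc ∣C∣≡k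
⊆-interpolate (outside ∷ A) (outside ∷ B) k A⊆B ∣A∣≤k k≤∣B∣
  with C , A⊆C , C⊆B , ∣C∣≡k ← ⊆-interpolate A B k (drop-∷-⊆ A⊆B) ∣A∣≤k k≤∣B∣
  = outside ∷ C , s⊆s A⊆C , s⊆s C⊆B , ∣C∣≡k
⊆-interpolate (outside ∷ A) (inside ∷ B) k A⊆B ∣A∣≤k k≤1+∣B∣ with k ≤? ∣ B ∣
... | yes k≤∣B∣ with C , A⊆C , C⊆B , ∣C∣≡k ← ⊆-interpolate A B k (drop-∷-⊆ A⊆B) ∣A∣≤k k≤∣B∣
  = outside ∷ C , s⊆s A⊆C , out⊆ C⊆B , ∣C∣≡k
... | no k≰∣B∣ = inside ∷ B , out⊆ (drop-∷-⊆ A⊆B) , ⊆-refl , ≤-antisym (≰⇒> k≰∣B∣) k≤1+∣B∣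

InSumset⇒∈⊕ : ∀ {p} .{{_ : NonZero p}} {A B : Subset p} {z} → InSumset A B z → z ∈ₛ A ⊕ B
InSumset⇒∈⊕ {A = A} {B} {z} z∈A+B = lookup⇒[]= z (A ⊕ B) (trans (lookup∘tabulate _ z) (decided (inSumset? A B z)))
  where
  decided : (d : Dec (InSumset A B z)) → ⌊ d ⌋ ≡ true
  decided (yes _) = refl
  decided (no z∉A+B) = contradiction z∈A+B z∉A+B

module Greedy {p : ℕ} .{{_ : NonZero p}} (X Y Z : Subset p) (target : ℕ)
  (room : 2 * (target + ∣ Z ∣) ≤ ∣ Y ∣) where

  open DecMembership (_≟_ {p}) using (_∈?_)

  blocked : List (Fin p) → List (Fin p)
  blocked T = T ++ elements Z

  fresh : List (Fin p) → Fin p → List (Fin p)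
  fresh T y = filter (λ x → ¬? ((x +ₚ y) ∈? blocked T)) (elements X)

  good-translate : ∀ T → length T < target → ∃[ y ] y ∈ₛ Y × ∣ X ∣ ≤ 2 * length (fresh T y)
  good-translate T T<target =
    let y , y∈ , half = sparse-column (λ x y → (x +ₚ y) ∈? blocked T) (elements X) (elements Y)
                          (length (blocked T)) row≤ few-blocked
    in y , ∈-elements⁻ y∈ , subst (_≤ 2 * length (fresh T y)) (length-elements X) half
    where
    row≤ : ∀ {x} → x ∈ elements X → length (filter (λ y → (x +ₚ y) ∈? blocked T) (elements Y)) ≤ length (blocked T)
    row≤ {x} _ = length-filter-preimage≤ _≟_ (x +ₚ_) (+ₚ-cancelˡ x) (elements-unique Y) (blocked T)
    open ≤-Reasoning
    few-blocked : 2 * length (blocked T) < length (elements Y)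
    few-blocked = begin-strict
      2 * length (blocked T)        ≡⟨ cong (2 *_) (trans (length-++ T) (cong (length T +_) (length-elements Z))) ⟩
      2 * (length T + ∣ Z ∣)        <⟨ *-monoʳ-< 2 (+-monoˡ-< ∣ Z ∣ T<target) ⟩
      2 * (target + ∣ Z ∣)          ≤⟨ room ⟩
      ∣ Y ∣                         ≡⟨ length-elements Y ⟨
      length (elements Y)           ∎

  record Stage (k : ℕ) : Set where
    field
      chosen      : Subset p
      chosen⊆Y    : chosen ⊆ Y
      ∣chosen∣≤k  : ∣ chosen ∣ ≤ k
      sums        : List (Fin p)
      sums-unique : Unique sums
      sums-good   : ∀ {z} → z ∈ sums → InSumset X chosen z × z ∉ₛ Z
      progress    : target ≤ length sums ⊎ k * ∣ X ∣ ≤ 2 * length sums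

  finished : ∀ {k} (st : Stage k) → target ≤ length (Stage.sums st) → Stage (suc k)
  finished st done = record
    { chosen = chosen ; chosen⊆Y = chosen⊆Y ; ∣chosen∣≤k = m≤n⇒m≤1+n ∣chosen∣≤k
    ; sums = sums ; sums-unique = sums-unique ; sums-good = sums-good ; progress = inj₁ done }
    where open Stage st

  extend : ∀ {k} (st : Stage k) → length (Stage.sums st) < target →
           k * ∣ X ∣ ≤ 2 * length (Stage.sums st) → Stage (suc k)
  extend {k} st short partial with y , y∈Y , half ← good-translate (Stage.sums st) short = record
    { chosen      = chosen ∪ ⁅ y ⁆
    ; chosen⊆Y    = chosen′⊆Y
    ; ∣chosen∣≤k  = ≤-trans (∣p∪q∣≤∣p∣+∣q∣ chosen ⁅ y ⁆)
                      (≤-trans (≤-reflexive (trans (cong (∣ chosen ∣ +_) (∣⁅x⁆∣≡1 y)) (+-comm ∣ chosen ∣ 1)))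
                               (s≤s ∣chosen∣≤k))
    ; sums        = sums ++ new
    ; sums-unique = Unique.++⁺ sums-unique new-unique new-disjoint
    ; sums-good   = good′
    ; progress    = inj₂ grown
    }
    where
    open Stage st
    new : List (Fin p)
    new = map (_+ₚ y) (fresh sums y)

    fresh-spec : ∀ {x} → x ∈ fresh sums y → x ∈ₛ X × (x +ₚ y) ∉ blocked sums
    fresh-spec x∈ with x∈X , unblocked ← ∈-filter⁻ _ {xs = elements X} x∈ = ∈-elements⁻ x∈X , unblocked

    new-unique : Unique new
    new-unique = Unique.map⁺ (+ₚ-cancelʳ y) (Unique.filter⁺ _ (elements-unique X))

    new-disjoint : ∀ {z} → ¬ (z ∈ sums × z ∈ new)
    new-disjoint (z∈sums , z∈new) with x , x∈ , refl ← ∈-map⁻ (_+ₚ y) z∈new =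
      proj₂ (fresh-spec x∈) (∈-++⁺ˡ z∈sums)

    chosen′⊆Y : chosen ∪ ⁅ y ⁆ ⊆ Y
    chosen′⊆Y z∈ with x∈p∪q⁻ chosen ⁅ y ⁆ z∈
    ... | inj₁ z∈chosen = chosen⊆Y z∈chosen
    ... | inj₂ z∈⁅y⁆    = subst (_∈ₛ Y) (sym (x∈⁅y⁆⇒x≡y y z∈⁅y⁆)) y∈Y

    good′ : ∀ {z} → z ∈ sums ++ new → InSumset X (chosen ∪ ⁅ y ⁆) z × z ∉ₛ Z
    good′ z∈ with ∈-++⁻ sums z∈
    ... | inj₁ z∈sums with (a , b , (a∈ , b∈) , a+b≡z) , z∉Z ← sums-good z∈sums =
      (a , b , (a∈ , p⊆p∪q ⁅ y ⁆ b∈) , a+b≡z) , z∉Z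
    ... | inj₂ z∈new with x , x∈ , refl ← ∈-map⁻ (_+ₚ y) z∈new =
      (x , y , (proj₁ (fresh-spec x∈) , q⊆p∪q chosen ⁅ y ⁆ (x∈⁅x⁆ y)) , refl) ,
      λ x+y∈Z → proj₂ (fresh-spec x∈) (∈-++⁺ʳ sums (∈-elements⁺ x+y∈Z))

    open ≤-Reasoning
    grown : suc k * ∣ X ∣ ≤ 2 * length (sums ++ new)
    grown = begin
      ∣ X ∣ + k * ∣ X ∣                          ≤⟨ +-mono-≤ half partial ⟩
      2 * length (fresh sums y) + 2 * length sums ≡⟨ +-comm _ (2 * length sums) ⟩
      2 * length sums + 2 * length (fresh sums y) ≡⟨ *-distribˡ-+ 2 (length sums) _ ⟨
      2 * (length sums + length (fresh sums y))
        ≡⟨ cong (λ m → 2 * (length sums + m)) (length-map (_+ₚ y) (fresh sums y)) ⟨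
      2 * (length sums + length new)              ≡⟨ cong (2 *_) (length-++ sums) ⟨
      2 * length (sums ++ new)                    ∎

  stage : ∀ k → Stage k
  stage zero = record
    { chosen = ⊥ ; chosen⊆Y = ⊥⊆ ; ∣chosen∣≤k = ≤-reflexive (∣⊥∣≡0 p)
    ; sums = [] ; sums-unique = [] ; sums-good = λ () ; progress = inj₂ z≤n }
  stage (suc k) with stage k
  ... | st with Stage.progress st | target ≤? length (Stage.sums st)
  ...   | inj₁ done    | _          = finished st done
  ...   | inj₂ _       | yes done   = finished st done
  ...   | inj₂ partial | no  short  = extend st (≰⇒> short) partial

  sums≤∣X⊕Y′∩∁Z∣ : ∀ {k} (st : Stage k) {Y′} → Stage.chosen st ⊆ Y′ → length (Stage.sums st) ≤ ∣ (X ⊕ Y′) ∩ ∁ Z ∣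
  sums≤∣X⊕Y′∩∁Z∣ st chosen⊆Y′ = length≤∣ _ ∣ (Stage.sums-unique st) sum∈
    where
    sum∈ : ∀ {z} → z ∈ Stage.sums st → z ∈ₛ (X ⊕ _) ∩ ∁ Z
    sum∈ z∈ with (a , b , (a∈ , b∈) , a+b≡z) , z∉Z ← Stage.sums-good st z∈ =
      x∈p∩q⁺ (InSumset⇒∈⊕ (a , b , (a∈ , chosen⊆Y′ b∈) , a+b≡z) , x∉p⇒x∈∁p z∉Z)

  Large : Subset p → ℕ → Set
  Large Y′ k = target ≤ ∣ (X ⊕ Y′) ∩ ∁ Z ∣ ⊎ k * ∣ X ∣ ≤ 2 * ∣ (X ⊕ Y′) ∩ ∁ Z ∣

  completion : ∀ {k} → Stage k → k ≤ ∣ Y ∣ → ∃[ Y′ ] (Y′ ⊆ Y × ∣ Y′ ∣ ≡ k) × Large Y′ k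
  completion {k} st k≤∣Y∣ = fill (⊆-interpolate chosen Y k chosen⊆Y ∣chosen∣≤k k≤∣Y∣)
    where
    open Stage st
    fill : ∃[ Y′ ] chosen ⊆ Y′ × Y′ ⊆ Y × ∣ Y′ ∣ ≡ k → ∃[ Y′ ] (Y′ ⊆ Y × ∣ Y′ ∣ ≡ k) × Large Y′ k
    fill (Y′ , chosen⊆Y′ , Y′⊆Y , ∣Y′∣≡k) =
      Y′ , (Y′⊆Y , ∣Y′∣≡k) ,
      Sum.map (λ done → ≤-trans done sums≤) (λ partial → ≤-trans partial (*-monoʳ-≤ 2 sums≤)) progress
      where
      sums≤ : length sums ≤ ∣ (X ⊕ Y′) ∩ ∁ Z ∣
      sums≤ = sums≤∣X⊕Y′∩∁Z∣ st chosen⊆Y′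

  greedy : ∀ k → k ≤ ∣ Y ∣ → ∃[ Y′ ] (Y′ ⊆ Y × ∣ Y′ ∣ ≡ k) × Large Y′ k
  greedy k = completion (stage k)

8x≤y⇒8z≤y⇒2[2x+z]≤y : ∀ {x y z} → 8 * x ≤ y → 8 * z ≤ y → 2 * (2 * x + z) ≤ y
8x≤y⇒8z≤y⇒2[2x+z]≤y {x} {y} {z} 8x≤y 8z≤y = *-cancelˡ-≤ 4 (begin
  4 * (2 * (2 * x + z))   ≡⟨ expand x z ⟩
  2 * (8 * x) + 8 * z     ≤⟨ +-mono-≤ (*-monoʳ-≤ 2 8x≤y) 8z≤y ⟩
  2 * y + y               ≤⟨ +-monoʳ-≤ (2 * y) (m≤n*m y 2) ⟩
  2 * y + 2 * y           ≡⟨ *-distribʳ-+ y 2 2 ⟨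
  4 * y                   ∎)
  where
  open ≤-Reasoning
  expand : ∀ x z → 4 * (2 * (2 * x + z)) ≡ 2 * (8 * x) + 8 * z
  expand = solve-∀

16x≤c⇒c≤2t⇒2x≤t : ∀ {x t c} → 16 * x ≤ c → c ≤ 2 * t → 2 * x ≤ t
16x≤c⇒c≤2t⇒2x≤t {x} {t} {c} 16x≤c c≤2t = ≤-trans (*-monoˡ-≤ x {2} {8} (s≤s (s≤s z≤n)))
  (*-cancelˡ-≤ 2 (≤-trans (≤-reflexive (sym (*-assoc 2 8 x))) (≤-trans 16x≤c c≤2t)))

lemma10 : (p : ℕ) .{{_ : NonZero p}} → Prime p →
    (X Y Z : Subset p) (c₁ c₂ : ℕ) →
    1 ≤ c₁ → c₁ ≤ ∣ X ∣ → 1 ≤ c₂ → c₂ ≤ ∣ Y ∣ →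
    16 * ∣ X ∣ ≤ c₁ * c₂ →
    8 * ∣ X ∣ ≤ ∣ Y ∣ → 8 * ∣ Z ∣ ≤ ∣ Y ∣ → 2 * ∣ Y ∣ < p →
    Σ (Subset p) λ X′ → Σ (Subset p) λ Y′ →
      ((X′ ⊆ X × ∣ X′ ∣ ≡ c₁) × (Y′ ⊆ Y × ∣ Y′ ∣ ≡ c₂)) ×
      2 * ∣ X ∣ ≤ ∣ (X′ ⊕ Y′) ∩ ∁ Z ∣
lemma10 p _ X Y Z c₁ c₂ _ c₁≤∣X∣ _ c₂≤∣Y∣ 16∣X∣≤c₁c₂ 8∣X∣≤∣Y∣ 8∣Z∣≤∣Y∣ _ =
  let X′ , _ , X′⊆X , ∣X′∣≡c₁ = ⊆-interpolate ⊥ X c₁ ⊥⊆ (≤-trans (≤-reflexive (∣⊥∣≡0 p)) z≤n) c₁≤∣X∣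
      Y′ , Y′-spec , large = Greedy.greedy X′ Y Z (2 * ∣ X ∣)
        (8x≤y⇒8z≤y⇒2[2x+z]≤y {x = ∣ X ∣} 8∣X∣≤∣Y∣ 8∣Z∣≤∣Y∣) c₂ c₂≤∣Y∣
      16∣X∣≤c₂∣X′∣ : 16 * ∣ X ∣ ≤ c₂ * ∣ X′ ∣
      16∣X∣≤c₂∣X′∣ = ≤-trans 16∣X∣≤c₁c₂ (≤-reflexive (trans (*-comm c₁ c₂) (cong (c₂ *_) (sym ∣X′∣≡c₁))))
  in X′ , Y′ , ((X′⊆X , ∣X′∣≡c₁) , Y′-spec) ,
     Sum.[ (λ done → done) , 16x≤c⇒c≤2t⇒2x≤t {x = ∣ X ∣} 16∣X∣≤c₂∣X′∣ ]′ large
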